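{- Let $X$ and $Y$ be strings, let $\tilde X$ be a contiguous subsequence of $X$ and $\tilde Y$ a contiguous subsequence of $Y$, and let $\tilde P$ be the first element of $\mathcal{P}(\tilde X,\tilde Y)$. Then for every element $P$ of $\mathcal{P}(\tilde X,\tilde Y)$ and every index $k$ with $1\le k\le L(\tilde X,\tilde Y)$, we have $\tilde P[k]\le P[k]$.
   Context: For a sequence $S$, $|S|$ is its length, $S[i]$ its $i$th element, $S[i:i']=S[i]\circ\cdots\circ S[i']$ (empty if $i=i'+1$), and for an index sequence $I=i_1\circ\cdots\circ i_\ell$ with $i_1<\dots<i_\ell$, $S[I]=S[i_1]\circ\cdots\circ S[i_\ell]$. A subsequence is obtained by deleting zero or more elements at arbitrary positions. $L(A,B)$ denotes the length of a longest common subsequence (LCS) of strings $A,B$. For a contiguous subsequence $\tilde X$ of $X$ and a contiguous subsequence $\tilde Y=Y[j':j'']$ of $Y$, an LCS-position sequence of $\tilde X$ and $\tilde Y$ is a sequence $P$ of $L(\tilde X,\tilde Y)$ increasing indices between $j'$ and $j''$ such that $Y[P]$ is an LCS of $\tilde X$ and $\tilde Y$ and, for every $k$ with $1\le k\le L(\tilde X,\tilde Y)$, $Y[j':P[k]]$ is the shortest prefix of $\tilde Y$ having $Y[P[1:k]]$ as a subsequence. $\mathcal{P}(\tilde X,\tilde Y)$ denotes the sequence of all LCS-position sequences of $\tilde X$ and $\tilde Y$ in lexicographic order. -}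

module Defs where

open import Data.Nat as ℕ using (ℕ; suc; _≤_; _<_; _≤?_)
open import Data.Fin as Fin using (Fin; toℕ)
open import Data.List using (List; map; filter; take; length; lookup; allFin)
open import Data.List.Relation.Binary.Sublist.Propositional using (_⊆_)
open import Data.List.Relation.Unary.All using (All)
open import Data.List.Relation.Unary.Linked using (Linked)
open import Data.List.Relation.Binary.Lex.Strict using (Lex-≤)
open import Data.Product using (_×_; ∃)
open import Relation.Nullary using (¬_)
open import Relation.Nullary.Decidable using (_×-dec_)
open import Relation.Binary.PropositionalEquality using (_≡_)

-- Strings over an alphabet A are lists; the string Y of length m is
-- represented as a function  Y : Fin m → A  (0-indexed positions).

segment : {A : Set} {m : ℕ} → (Fin m → A) → ℕ → ℕ → List A
segment {m = m} Y j' j'' =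
  map Y (filter (λ i → (j' ≤? toℕ i) ×-dec (toℕ i ≤? j'')) (allFin m))

IsLCSLength : {A : Set} → List A → List A → ℕ → Set
IsLCSLength S T ℓ =
  (∃ λ Z → Z ⊆ S × Z ⊆ T × length Z ≡ ℓ)
  × (∀ Z → Z ⊆ S → Z ⊆ T → length Z ≤ ℓ)

IsLCSPos : {A : Set} {m : ℕ} → List A → (Fin m → A) → ℕ → ℕ → List (Fin m) → Set
IsLCSPos X̃ Y j' j'' P =
  IsLCSLength X̃ (segment Y j' j'') (length P)
  × Linked Fin._<_ P
  × All (λ i → j' ≤ toℕ i × toℕ i ≤ j'') P
  × map Y P ⊆ X̃
  × map Y P ⊆ segment Y j' j''
  -- for every k, Y[j':P[k]] is the shortest prefix of Ỹ having Y[P[1:k]]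
  -- as a subsequence
  × (∀ (k : Fin (length P)) →
       (map Y (take (suc (toℕ k)) P) ⊆ segment Y j' (toℕ (lookup P k)))
       × (∀ e → e < toℕ (lookup P k) →
            ¬ (map Y (take (suc (toℕ k)) P) ⊆ segment Y j' e)))

_≤lex_ : {m : ℕ} → List (Fin m) → List (Fin m) → Set
_≤lex_ = Lex-≤ _≡_ Fin._<_

IsFirstLCSPos : {A : Set} {m : ℕ} → List A → (Fin m → A) → ℕ → ℕ → List (Fin m) → Set
IsFirstLCSPos X̃ Y j' j'' P̃ =
  IsLCSPos X̃ Y j' j'' P̃ × (∀ P → IsLCSPos X̃ Y j' j'' P → P̃ ≤lex P)

{-# OPTIONS --safe #-}
module Submission where

-- Suppose P̃ and P first violate P̃ ≤ P at index k: P̃ = as ++ a ∷ as', P = bs ++ b ∷ bs'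
-- with as ≤ bs pointwise and b < a.  Comparing where a and b land in embeddings of Y[P̃]
-- and Y[P] into X̃, either Y[as ++ b ∷ bs'] or Y[bs ++ b ∷ a ∷ as'] is a subsequence of X̃.
-- The latter is a common subsequence of X̃ and Ỹ of length L + 1, which is impossible.
-- The former has length L; moving each of its positions to the leftmost possible
-- occurrence in Ỹ (greedy matching) gives an LCS-position sequence pointwise below it,
-- hence lexicographically smaller than P̃, contradicting the minimality of P̃.

open import Defs
open import Data.Nat using (ℕ; suc; _≤_)
open import Data.Fin as Fin using (Fin)
open import Data.List using (List; drop; take)
open import Data.List.Relation.Binary.Pointwise using (Pointwise)
open import Data.Product using (∃₂)
open import Relation.Binary.PropositionalEquality using (_≡_)

open import Data.Nat using (zero; _<_; _+_; _≤?_)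
open import Data.Nat.Properties
  using (≤-refl; ≤-trans; <⇒≤; ≤-<-trans; <⇒≱; ≮⇒≥; ≤-<-connex; ≤-antisym;
         suc-injective; +-monoʳ-<; n<1+n; module ≤-Reasoning)
open import Data.Fin using (toℕ; fromℕ<)
open import Data.Fin.Properties
  using (¬∀⟶∃¬-smallest; ∀-cons; toℕ-inject; toℕ-fromℕ<; toℕ-injective)
  renaming (<-irrefl to <ᶠ-irrefl; <-trans to <ᶠ-trans)
open import Data.List using ([]; _∷_; _++_; [_]; map; filter; length; lookup; allFin)
open import Data.List.Properties
  using (map-++; length-++; length-map; ++-assoc; take++drop≡id; take-suc)
open import Data.List.Membership.Propositional using (_∈_)
open import Data.List.Membership.Propositional.Properties using (∈-filter⁺; ∈-allFin; ∈-lookup)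
open import Data.List.Relation.Binary.Lex.Strict using (this; next)
open import Data.List.Relation.Binary.Pointwise as Pointwise using ([]; _∷_; Pointwise-≡⇒≡)
open import Data.List.Relation.Binary.Pointwise.Properties using (Pointwise-length)
open import Data.List.Relation.Binary.Sublist.Heterogeneous using (Sublist; minimum)
import Data.List.Relation.Binary.Sublist.Heterogeneous.Properties as Sublistₚ
open import Data.List.Relation.Binary.Sublist.Propositional using (_⊆_; []; _∷_; _∷ʳ_; ⊆-trans)
open import Data.List.Relation.Binary.Sublist.Propositional.Properties using (take⁺)
import Data.List.Relation.Binary.Sublist.Propositional.Properties as ⊆
open import Data.List.Relation.Unary.All as All using (All; []; _∷_)
import Data.List.Relation.Unary.All.Properties as All
open import Data.List.Relation.Unary.AllPairs using (AllPairs; []; _∷_)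
import Data.List.Relation.Unary.AllPairs.Properties as AllPairs
open import Data.List.Relation.Unary.Any using (here; there)
open import Data.List.Relation.Unary.Linked using (Linked; []; [-]; _∷_)
open import Data.List.Relation.Unary.Linked.Properties using (Linked⇒AllPairs; AllPairs⇒Linked)
open import Data.Empty using (⊥; ⊥-elim)
open import Data.Product using (∃; _×_; _,_; proj₁; proj₂)
open import Data.Sum using (_⊎_; inj₁; inj₂)
open import Function using (_∘_; id)
open import Level using (Level; 0ℓ)
open import Relation.Binary using (Rel; REL; Irreflexive; Transitive)
open import Relation.Binary.PropositionalEquality
  using (refl; sym; trans; cong; subst; subst₂; module ≡-Reasoning)
open import Relation.Nullary using (¬_; Dec; ¬?)
open import Relation.Nullary.Decidable using (_×-dec_; decidable-stable; ¬¬-excluded-middle)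
open import Relation.Unary using (Pred; Decidable)

private
  variable
    a b p r : Level
    A B : Set a
    n : ℕ

¬¬-∀-Fin : ∀ n {P : Pred (Fin n) p} → (∀ i → ¬ ¬ P i) → ¬ ¬ (∀ i → P i)
¬¬-∀-Fin zero    _   k = k (λ ())
¬¬-∀-Fin (suc n) ¬¬P k = ¬¬P Fin.zero (λ P₀ → ¬¬-∀-Fin n (¬¬P ∘ Fin.suc) (k ∘ ∀-cons P₀))

least-witness : {P : Pred (Fin n) p} → Decidable P → ∀ {q} → P q →
  ∃ λ g → P g × g Fin.≤ q × (∀ {t} → t Fin.< g → ¬ P t)
least-witness {n} {P = P} P? {q} Pq
  with ¬∀⟶∃¬-smallest n (¬_ ∘ P) (¬? ∘ P?) (λ ∀¬P → ∀¬P q Pq)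
... | g , ¬¬Pg , earlier = g , decidable-stable (P? g) ¬¬Pg , ≮⇒≥ (λ q<g → below q<g Pq) , below
  where
  below : ∀ {t} → t Fin.< g → ¬ P t
  below {t} t<g =
    subst (¬_ ∘ P) (toℕ-injective (trans (toℕ-inject j) (toℕ-fromℕ< t<g))) (earlier j)
    where
    j : Fin (toℕ g)
    j = fromℕ< t<g

module _ {R : REL A B r} where

  pointwise-by-prefix : ∀ {xs ys} → length xs ≡ length ys →
    (∀ {as x as' bs y bs'} → xs ≡ as ++ x ∷ as' → ys ≡ bs ++ y ∷ bs' →
       Pointwise R as bs → length as' ≡ length bs' → R x y) →
    Pointwise R xs ys
  pointwise-by-prefix {[]}     {[]}     _  _    = []
  pointwise-by-prefix {x ∷ xs} {y ∷ ys} eq R-at =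
    Rxy ∷ pointwise-by-prefix (suc-injective eq)
            (λ xs≡ ys≡ pw → R-at (cong (x ∷_) xs≡) (cong (y ∷_) ys≡) (Rxy ∷ pw))
    where
    Rxy : R x y
    Rxy = R-at {as = []} {bs = []} refl refl [] (suc-injective eq)

  pointwise-All : {P : Pred A p} {Q : Pred B p} → (∀ {x y} → R x y → Q y → P x) →
    ∀ {xs ys} → Pointwise R xs ys → All Q ys → All P xs
  pointwise-All R⇒ []         []         = []
  pointwise-All R⇒ (Rxy ∷ pw) (Qy ∷ Qys) = R⇒ Rxy Qy ∷ pointwise-All R⇒ pw Qys

module _ {A : Set a} where

  split-⊆ : ∀ xs {ys zs : List A} → xs ++ ys ⊆ zs → ∃ λ u → xs ⊆ take u zs × ys ⊆ drop u zs
  split-⊆ []       σ          = 0 , [] , σ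
  split-⊆ (x ∷ xs) (z ∷ʳ σ)   = let u , τ , ρ = split-⊆ (x ∷ xs) σ in suc u , z ∷ʳ τ , ρ
  split-⊆ (x ∷ xs) (refl ∷ σ) = let u , τ , ρ = split-⊆ xs σ in suc u , refl ∷ τ , ρ

  split-⊆-at : ∀ xs {y} {ys zs : List A} → xs ++ y ∷ ys ⊆ zs →
    ∃ λ v → xs ++ [ y ] ⊆ take (suc v) zs × y ∷ ys ⊆ drop v zs
  split-⊆-at []       (z ∷ʳ σ)   = let v , τ , ρ = split-⊆-at [] σ in suc v , z ∷ʳ τ , ρ
  split-⊆-at []       (refl ∷ σ) = 0 , refl ∷ [] , refl ∷ σ
  split-⊆-at (x ∷ xs) (z ∷ʳ σ)   = let v , τ , ρ = split-⊆-at (x ∷ xs) σ in suc v , z ∷ʳ τ , ρ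
  split-⊆-at (x ∷ xs) (refl ∷ σ) = let v , τ , ρ = split-⊆-at xs σ in suc v , refl ∷ τ , ρ

  ⊆-interleave : ∀ as {x as'} bs {y bs'} {zs : List A} →
    as ++ x ∷ as' ⊆ zs → bs ++ y ∷ bs' ⊆ zs →
    as ++ y ∷ bs' ⊆ zs ⊎ bs ++ y ∷ x ∷ as' ⊆ zs
  ⊆-interleave as {x} {as'} bs {y} {bs'} {zs} σ τ
    with split-⊆ as σ | split-⊆-at bs τ
  ... | u , as⊆ , xas'⊆ | v , bsy⊆ , ybs'⊆ with ≤-<-connex u v
  ... | inj₁ u≤v = inj₁ (subst (as ++ y ∷ bs' ⊆_) (take++drop≡id v zs)
                          (Sublistₚ.++⁺ (⊆-trans as⊆ (take⁺ u≤v)) ybs'⊆))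
  ... | inj₂ v<u = inj₂ (subst₂ _⊆_ (++-assoc bs [ y ] (x ∷ as')) (take++drop≡id u zs)
                          (Sublistₚ.++⁺ (⊆-trans bsy⊆ (take⁺ v<u)) xas'⊆))

  lookup-All-take : {P : Pred A p} (xs : List A) (k : Fin (length xs)) →
    All P (take (suc (toℕ k)) xs) → P (lookup xs k)
  lookup-All-take {P = P} xs k = proj₂ ∘ All.∷ʳ⁻ ∘ subst (All P) (take-suc xs k)

module _ {A : Set a} {R : Rel A r} where

  Linked-++-∷⁻ : ∀ xs {y ys} → Linked R (xs ++ y ∷ ys) → Linked R (xs ++ [ y ]) × Linked R (y ∷ ys)
  Linked-++-∷⁻ []            l       = [-] , l
  Linked-++-∷⁻ (x ∷ [])      (r ∷ l) = r ∷ [-] , l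
  Linked-++-∷⁻ (x ∷ x' ∷ xs) (r ∷ l) = let l₁ , l₂ = Linked-++-∷⁻ (x' ∷ xs) l in r ∷ l₁ , l₂

  Linked-++-∷⁺ : ∀ xs {y ys} → Linked R (xs ++ [ y ]) → Linked R (y ∷ ys) → Linked R (xs ++ y ∷ ys)
  Linked-++-∷⁺ []            _       l = l
  Linked-++-∷⁺ (x ∷ [])      (r ∷ _) l = r ∷ l
  Linked-++-∷⁺ (x ∷ x' ∷ xs) (r ∷ k) l = r ∷ Linked-++-∷⁺ (x' ∷ xs) k l

module _ {A : Set a} {_<_ : Rel A r}
         (<-irrefl : Irreflexive _≡_ _<_) (<-trans : Transitive _<_) where

  ∈-tail : ∀ {y z ys} → y < z × z ∈ y ∷ ys → z ∈ ys
  ∈-tail (y<z , here refl) = ⊥-elim (<-irrefl refl y<z)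
  ∈-tail (_   , there z∈)  = z∈

  AllPairs-⊆ : ∀ {xs ys} → AllPairs _<_ ys → AllPairs _<_ xs → All (_∈ ys) xs → xs ⊆ ys
  AllPairs-⊆ {[]} _ _ _ = minimum _
  AllPairs-⊆ {x ∷ xs} {y ∷ ys} (y< ∷ ys↑) (x< ∷ xs↑) (here refl ∷ xs∈) =
    refl ∷ AllPairs-⊆ ys↑ xs↑ (All.zipWith ∈-tail (x< , xs∈))
  AllPairs-⊆ {x ∷ xs} {y ∷ ys} (y< ∷ ys↑) (x< ∷ xs↑) (there x∈ ∷ xs∈) =
    y ∷ʳ AllPairs-⊆ ys↑ (x< ∷ xs↑) (x∈ ∷ All.zipWith ∈-tail (y<xs , xs∈))
    where
    y<xs : All (y <_) xs
    y<xs = All.map (<-trans (All.lookup y< x∈)) x<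

module _ {m : ℕ} where

  take-≤-lookup : ∀ {xs : List (Fin m)} → AllPairs Fin._<_ xs → (k : Fin (length xs)) →
    All (Fin._≤ lookup xs k) (take (suc (toℕ k)) xs)
  take-≤-lookup (_  ∷ _)   Fin.zero    = ≤-refl ∷ []
  take-≤-lookup (x< ∷ xs↑) (Fin.suc k) = <⇒≤ (All.lookup x< (∈-lookup k)) ∷ take-≤-lookup xs↑ k

  Linked-∷ʳ-below : ∀ {xs ys : List (Fin m)} {x y} → Pointwise Fin._≤_ xs ys →
    Linked Fin._<_ (xs ++ [ x ]) → Linked Fin._<_ (ys ++ [ y ]) → Linked Fin._<_ (xs ++ [ y ])
  Linked-∷ʳ-below []               _       _       = [-]
  Linked-∷ʳ-below (x≤y ∷ [])       _       (r ∷ _) = ≤-<-trans x≤y r ∷ [-]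
  Linked-∷ʳ-below (_ ∷ pw@(_ ∷ _)) (r ∷ k) (_ ∷ l) = r ∷ Linked-∷ʳ-below pw k l

  ¬≤lex-pointwise-below : ∀ (as : List (Fin m)) {x as' y bs' G} →
    Pointwise Fin._≤_ G (as ++ y ∷ bs') → y Fin.< x → ¬ (as ++ x ∷ as') ≤lex G
  ¬≤lex-pointwise-below []       (g≤y ∷ _) y<x (this x<g)    = <⇒≱ (≤-<-trans g≤y y<x) (<⇒≤ x<g)
  ¬≤lex-pointwise-below []       (g≤y ∷ _) y<x (next refl _) = <⇒≱ y<x g≤y
  ¬≤lex-pointwise-below (a ∷ as) (g≤a ∷ _) _   (this a<g)    = <⇒≱ a<g g≤a
  ¬≤lex-pointwise-below (a ∷ as) (_ ∷ pw)  y<x (next _ lex)  = ¬≤lex-pointwise-below as pw y<x lex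

IsLCSLength-unique : ∀ {S T : List A} {ℓ ℓ'} → IsLCSLength S T ℓ → IsLCSLength S T ℓ' → ℓ ≡ ℓ'
IsLCSLength-unique ((Z , Z⊆S , Z⊆T , refl) , max) ((Z' , Z'⊆S , Z'⊆T , refl) , max') =
  ≤-antisym (max' Z Z⊆S Z⊆T) (max Z' Z'⊆S Z'⊆T)

module Positions {A : Set} {m : ℕ} (Y : Fin m → A) where

  InRange : ℕ → ℕ → Pred (Fin m) 0ℓ
  InRange lo hi i = lo ≤ toℕ i × toℕ i ≤ hi

  inRange? : ∀ lo hi → Decidable (InRange lo hi)
  inRange? lo hi i = (lo ≤? toℕ i) ×-dec (toℕ i ≤? hi)

  window : ℕ → ℕ → List (Fin m)
  window lo hi = filter (inRange? lo hi) (allFin m)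

  window-increasing : ∀ lo hi → AllPairs Fin._<_ (window lo hi)
  window-increasing lo hi = AllPairs.filter⁺ (inRange? lo hi) (AllPairs.tabulate⁺-< id)

  ⊆-segment : ∀ {lo hi H} → AllPairs Fin._<_ H → All (InRange lo hi) H → map Y H ⊆ segment Y lo hi
  ⊆-segment {lo} {hi} H↑ H∈ =
    ⊆.map⁺ Y (AllPairs-⊆ <ᶠ-irrefl <ᶠ-trans (window-increasing lo hi) H↑
               (All.map (∈-filter⁺ (inRange? lo hi) (∈-allFin _)) H∈))

  -- Each g in G is the first occurrence of the letter Y g at or after lo (for the head)
  -- resp. after its predecessor: G is the greedy embedding of map Y G into Y from lo on.
  data Leftmost : ℕ → List (Fin m) → Set where
    []  : ∀ {lo} → Leftmost lo []
    _∷_ : ∀ {lo g G} → lo ≤ toℕ g × (∀ {t} → t Fin.< g → ¬ (lo ≤ toℕ t × Y t ≡ Y g)) →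
          Leftmost (suc (toℕ g)) G → Leftmost lo (g ∷ G)

  leftmost-take : ∀ {lo G} k → Leftmost lo G → Leftmost lo (take k G)
  leftmost-take zero    _         = []
  leftmost-take (suc k) []        = []
  leftmost-take (suc k) (g← ∷ G←) = g← ∷ leftmost-take k G←

  leftmost-≥ : ∀ {lo G} → Leftmost lo G → All (λ g → lo ≤ toℕ g) G
  leftmost-≥ []                = []
  leftmost-≥ ((lo≤g , _) ∷ G←) = lo≤g ∷ All.map (≤-trans lo≤g ∘ <⇒≤) (leftmost-≥ G←)

  leftmost-increasing : ∀ {lo G} → Leftmost lo G → AllPairs Fin._<_ G
  leftmost-increasing []       = []
  leftmost-increasing (_ ∷ G←) = leftmost-≥ G← ∷ leftmost-increasing G←

  leftmost-≤ : ∀ {lo hi H T} → Leftmost lo H → Sublist (λ h t → Y h ≡ Y t) H T →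
    AllPairs Fin._<_ T → All (InRange lo hi) T → All (λ h → toℕ h ≤ hi) H
  leftmost-≤ [] _ _ _ = []
  leftmost-≤ H← (_ ∷ʳ σ) (_ ∷ T↑) (_ ∷ T∈) = leftmost-≤ H← σ T↑ T∈
  leftmost-≤ {lo} {hi} {h ∷ _} {t ∷ _}
             ((_ , first) ∷ H←) (Yh≡Yt ∷ σ) (t< ∷ T↑) ((lo≤t , t≤hi) ∷ T∈) =
    ≤-trans h≤t t≤hi ∷ leftmost-≤ H← σ T↑ (All.zipWith above-h (t< , T∈))
    where
    h≤t : h Fin.≤ t
    h≤t = ≮⇒≥ (λ t<h → first t<h (lo≤t , sym Yh≡Yt))
    above-h : ∀ {t'} → t Fin.< t' × InRange lo hi t' → InRange (suc (toℕ h)) hi t'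
    above-h (t<t' , _ , t'≤hi) = ≤-<-trans h≤t t<t' , t'≤hi

  leftmost-shortest : ∀ {lo hi H} → Leftmost lo H → map Y H ⊆ segment Y lo hi →
    All (λ h → toℕ h ≤ hi) H
  leftmost-shortest {lo} {hi} H← σ =
    leftmost-≤ H← (Sublistₚ.map⁻ Y Y σ) (window-increasing lo hi)
      (All.all-filter (inRange? lo hi) (allFin m))

  leftmost-IsLCSPos : ∀ {X̃ j' j'' G} → Leftmost j' G → All (λ g → toℕ g ≤ j'') G →
    map Y G ⊆ X̃ → IsLCSLength X̃ (segment Y j' j'') (length G) → IsLCSPos X̃ Y j' j'' G
  leftmost-IsLCSPos {j' = j'} {j''} {G} G← G≤j'' G⊆X̃ lcs =
    lcs , AllPairs⇒Linked G↑ , G∈ , G⊆X̃ , ⊆-segment G↑ G∈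
        , λ k → prefix-ends-at k , prefix-shortest k
    where
    G↑ : AllPairs Fin._<_ G
    G↑ = leftmost-increasing G←
    G∈ : All (InRange j' j'') G
    G∈ = All.zip (leftmost-≥ G← , G≤j'')
    prefix← : (k : Fin (length G)) → Leftmost j' (take (suc (toℕ k)) G)
    prefix← k = leftmost-take (suc (toℕ k)) G←
    prefix-ends-at : (k : Fin (length G)) →
      map Y (take (suc (toℕ k)) G) ⊆ segment Y j' (toℕ (lookup G k))
    prefix-ends-at k = ⊆-segment (leftmost-increasing (prefix← k))
                                 (All.zip (leftmost-≥ (prefix← k) , take-≤-lookup G↑ k))
    prefix-shortest : (k : Fin (length G)) →
      ∀ e → e < toℕ (lookup G k) → ¬ map Y (take (suc (toℕ k)) G) ⊆ segment Y j' e
    prefix-shortest k e e<gₖ σ = <⇒≱ e<gₖ (lookup-All-take G k (leftmost-shortest (prefix← k) σ))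

  module _ (_≟Y_ : ∀ s t → Dec (Y s ≡ Y t)) where

    leftmost-below : ∀ lo {Q} → AllPairs Fin._<_ Q → All (λ q → lo ≤ toℕ q) Q →
      ∃ λ G → Leftmost lo G × Pointwise (λ g q → g Fin.≤ q × Y g ≡ Y q) G Q
    leftmost-below lo         []         []         = [] , [] , []
    leftmost-below lo {q ∷ Q} (q< ∷ Q↑) (lo≤q ∷ _) =
      let g , (lo≤g , Yg≡Yq) , g≤q , before =
            least-witness (λ t → (lo ≤? toℕ t) ×-dec (t ≟Y q)) (lo≤q , refl)
          G , G← , G≼Q = leftmost-below (suc (toℕ g)) Q↑ (All.map (≤-<-trans g≤q) q<)
      in  g ∷ G
        , (lo≤g , λ t<g (lo≤t , Yt≡Yg) → before t<g (lo≤t , trans Yt≡Yg Yg≡Yq)) ∷ G←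
        , (g≤q , Yg≡Yq) ∷ G≼Q

    IsLCSPos-below : ∀ {X̃ j' j'' Q} → AllPairs Fin._<_ Q → All (InRange j' j'') Q →
      map Y Q ⊆ X̃ → IsLCSLength X̃ (segment Y j' j'') (length Q) →
      ∃ λ G → IsLCSPos X̃ Y j' j'' G × Pointwise Fin._≤_ G Q
    IsLCSPos-below {X̃} {j'} {j''} Q↑ Q∈ Q⊆X̃ lcs with leftmost-below j' Q↑ (All.map proj₁ Q∈)
    ... | G , G← , G≼Q =
        G
      , leftmost-IsLCSPos G← (pointwise-All (λ (g≤q , _) (_ , q≤j'') → ≤-trans g≤q q≤j'') G≼Q Q∈)
          (subst (_⊆ X̃) (sym (Pointwise-≡⇒≡ (Pointwise.map⁺ Y Y (Pointwise.map proj₂ G≼Q)))) Q⊆X̃)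
          (subst (IsLCSLength X̃ (segment Y j' j'')) (sym (Pointwise-length G≼Q)) lcs)
      , Pointwise.map proj₁ G≼Q

module Divergence {A : Set} {m : ℕ} (X̃ : List A) (Y : Fin m → A) (j' j'' : ℕ) where
  open Positions Y

  module _ (as : List (Fin m)) {a : Fin m} {as' : List (Fin m)}
           (bs : List (Fin m)) {b : Fin m} {bs' : List (Fin m)}
           (as≤bs : Pointwise Fin._≤_ as bs) (b<a : b Fin.< a) where

    first-LCSPos-prefix-splice : (∀ s t → Dec (Y s ≡ Y t)) →
      IsFirstLCSPos X̃ Y j' j'' (as ++ a ∷ as') → IsLCSPos X̃ Y j' j'' (bs ++ b ∷ bs') →
      length as' ≡ length bs' → ¬ map Y (as ++ b ∷ bs') ⊆ X̃
    first-LCSPos-prefix-splice _≟Y_ ((P̃-lcs , P̃↑ , P̃∈ , _) , P̃-first) (_ , P↑ , P∈ , _)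
                               |as'|≡|bs'| Q⊆X̃
      with IsLCSPos-below _≟Y_ Q↑ Q∈ Q⊆X̃ Q-lcs
      where
      Q↑ : AllPairs Fin._<_ (as ++ b ∷ bs')
      Q↑ = Linked⇒AllPairs <ᶠ-trans (Linked-++-∷⁺ as as∷ʳb↑ (proj₂ (Linked-++-∷⁻ bs P↑)))
        where
        as∷ʳb↑ : Linked Fin._<_ (as ++ [ b ])
        as∷ʳb↑ = Linked-∷ʳ-below as≤bs (proj₁ (Linked-++-∷⁻ as P̃↑)) (proj₁ (Linked-++-∷⁻ bs P↑))
      Q∈ : All (InRange j' j'') (as ++ b ∷ bs')
      Q∈ = All.++⁺ (All.++⁻ˡ as P̃∈) (All.++⁻ʳ bs P∈)
      same-length : length (as ++ a ∷ as') ≡ length (as ++ b ∷ bs')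
      same-length = begin
        length (as ++ a ∷ as')       ≡⟨ length-++ as ⟩
        length as + suc (length as') ≡⟨ cong (λ k → length as + suc k) |as'|≡|bs'| ⟩
        length as + suc (length bs') ≡⟨ length-++ as ⟨
        length (as ++ b ∷ bs')       ∎
        where open ≡-Reasoning
      Q-lcs : IsLCSLength X̃ (segment Y j' j'') (length (as ++ b ∷ bs'))
      Q-lcs = subst (IsLCSLength X̃ (segment Y j' j'')) same-length P̃-lcs
    ... | G , G-pos , G≤Q = ¬≤lex-pointwise-below as G≤Q b<a (P̃-first G G-pos)

    LCSPos-suffix-splice :
      IsLCSPos X̃ Y j' j'' (as ++ a ∷ as') → IsLCSPos X̃ Y j' j'' (bs ++ b ∷ bs') →
      ¬ map Y (bs ++ b ∷ a ∷ as') ⊆ X̃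
    LCSPos-suffix-splice (P̃-lcs , P̃↑ , P̃∈ , _) (_ , P↑ , P∈ , _) Z⊆X̃ =
      <⇒≱ longer (proj₂ P̃-lcs (map Y Z) Z⊆X̃ (⊆-segment Z↑ Z∈))
      where
      Z : List (Fin m)
      Z = bs ++ b ∷ a ∷ as'
      Z↑ : AllPairs Fin._<_ Z
      Z↑ = Linked⇒AllPairs <ᶠ-trans
             (Linked-++-∷⁺ bs (proj₁ (Linked-++-∷⁻ bs P↑)) (b<a ∷ proj₂ (Linked-++-∷⁻ as P̃↑)))
      Z∈ : All (InRange j' j'') Z
      Z∈ = All.++⁺ (All.++⁻ˡ bs P∈) (All.head (All.++⁻ʳ bs P∈) ∷ All.++⁻ʳ as P̃∈)
      longer : length (as ++ a ∷ as') < length (map Y Z)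
      longer = begin-strict
        length (as ++ a ∷ as')           ≡⟨ length-++ as ⟩
        length as + suc (length as')     ≡⟨ cong (_+ _) (Pointwise-length as≤bs) ⟩
        length bs + suc (length as')     <⟨ +-monoʳ-< (length bs) (n<1+n _) ⟩
        length bs + length (b ∷ a ∷ as') ≡⟨ length-++ bs ⟨
        length Z                         ≡⟨ length-map Y Z ⟨
        length (map Y Z)                 ∎
        where open ≤-Reasoning

    first-LCSPos-stays-below : (∀ s t → Dec (Y s ≡ Y t)) →
      IsFirstLCSPos X̃ Y j' j'' (as ++ a ∷ as') → IsLCSPos X̃ Y j' j'' (bs ++ b ∷ bs') →
      length as' ≡ length bs' → ⊥
    first-LCSPos-stays-below _≟Y_ P̃-first@((_ , _ , _ , P̃⊆X̃ , _) , _) P-pos@(_ , _ , _ , P⊆X̃ , _)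
                             |as'|≡|bs'|
      with ⊆-interleave (map Y as) (map Y bs) (map-++-⊆ as P̃⊆X̃) (map-++-⊆ bs P⊆X̃)
      where
      map-++-⊆ : ∀ xs {y ys} → map Y (xs ++ y ∷ ys) ⊆ X̃ → map Y xs ++ Y y ∷ map Y ys ⊆ X̃
      map-++-⊆ xs {y} {ys} = subst (_⊆ X̃) (map-++ Y xs (y ∷ ys))
    ... | inj₁ Q⊆X̃ = first-LCSPos-prefix-splice _≟Y_ P̃-first P-pos |as'|≡|bs'|
                       (subst (_⊆ X̃) (sym (map-++ Y as (b ∷ bs'))) Q⊆X̃)
    ... | inj₂ Z⊆X̃ = LCSPos-suffix-splice (proj₁ P̃-first) P-pos
                       (subst (_⊆ X̃) (sym (map-++ Y bs (b ∷ a ∷ as'))) Z⊆X̃)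

lemma4 : {A : Set} {m : ℕ} (X X̃ : List A) (Y : Fin m → A) (j' j'' : ℕ) →
    (∃₂ λ a b → X̃ ≡ take b (drop a X)) →
    j' ≤ suc j'' →
    (P̃ : List (Fin m)) → IsFirstLCSPos X̃ Y j' j'' P̃ →
    (P : List (Fin m)) → IsLCSPos X̃ Y j' j'' P →
    Pointwise Fin._≤_ P̃ P
lemma4 {m = m} _ X̃ Y j' j'' _ _ P̃ P̃-first P P-pos =
  pointwise-by-prefix (IsLCSLength-unique (proj₁ (proj₁ P̃-first)) (proj₁ P-pos)) at-divergence
  where
  at-divergence : ∀ {as a as' bs b bs'} → P̃ ≡ as ++ a ∷ as' → P ≡ bs ++ b ∷ bs' →
    Pointwise Fin._≤_ as bs → length as' ≡ length bs' → a Fin.≤ b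
  at-divergence {as} {bs = bs} refl refl as≤bs |as'|≡|bs'| = ≮⇒≥ λ b<a →
    -- Letters need not have decidable equality, but the goal is now ⊥, so the finitely
    -- many instances Y s ≡ Y t may be assumed decidable (double-negated excluded middle).
    ¬¬-∀-Fin m (λ s → ¬¬-∀-Fin m (λ t → ¬¬-excluded-middle)) λ _≟Y_ →
      Divergence.first-LCSPos-stays-below X̃ Y j' j'' as bs as≤bs b<a
        _≟Y_ P̃-first P-pos |as'|≡|bs'|
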